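{- Let $X$ be a graph whose adjacency matrix has spectral decomposition $A(X)=\sum_\theta \theta E_\theta$, where $\theta$ ranges over the distinct eigenvalues and $E_\theta$ is the orthogonal projection onto the $\theta$-eigenspace. Let $X^{\square 2}=X\square X$ with diagonal $D=\{(i,i):i\in V(X)\}$ (identified with $V(X)$). Then \[ W_{D,D}(X^{\square 2},t)=\sum_{\theta,\tau}(1-t(\theta+\tau))^{ -1}\,E_\theta\circ E_\tau, \] where $\circ$ is the entrywise (Schur) product.
   Context: The Cartesian product $X\square X$ has vertex set $V(X)\times V(X)$ and adjacency matrix $A\otimes I+I\otimes A$. For a graph $Z$ with adjacency matrix $A$, the walk-generating function is the formal power series $W(Z,t)=\sum_{r\ge0}A^rt^r$ (a matrix of power series), and for $S\subseteq V(Z)$, $W_{S,S}(Z,t)$ is its submatrix with rows and columns indexed by $S$. -}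

module Defs where

open import Level using (Level)
open import Algebra.Bundles using (CommutativeRing)
open import Data.Nat using (ℕ; zero; suc)
open import Data.Fin using (Fin; zero; suc)
open import Data.Fin.Properties using (_≟_)
open import Data.Bool using (Bool; true; false; if_then_else_)
open import Data.Product using (_×_; _,_)
open import Relation.Nullary using (¬_; Dec; yes; no)
open import Relation.Binary.PropositionalEquality using (_≡_)

record Graph (n : ℕ) : Set where
  field
    adj   : Fin n → Fin n → Bool
    sym   : ∀ i j → adj i j ≡ adj j i
    irrefl : ∀ i → adj i i ≡ false

module Spectral {c ℓ : Level} (R : CommutativeRing c ℓ) where
  open CommutativeRing R using (Carrier; _≈_; _+_; _*_; 0#; 1#)

  Mat : Set → Set c
  Mat I = I → I → Carrier

  Σ : (n : ℕ) → (Fin n → Carrier) → Carrier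
  Σ zero    f = 0#
  Σ (suc n) f = f zero + Σ n (λ i → f (suc i))

  δ : {n : ℕ} → Fin n → Fin n → Carrier
  δ i j with i ≟ j
  ... | yes _ = 1#
  ... | no  _ = 0#

  zeroM : {n : ℕ} → Mat (Fin n)
  zeroM i j = 0#

  idM : {n : ℕ} → Mat (Fin n)
  idM = δ

  _·_ : {n : ℕ} → Mat (Fin n) → Mat (Fin n) → Mat (Fin n)
  _·_ {n} M N i j = Σ n (λ k → M i k * N k j)

  _^_ : Carrier → ℕ → Carrier
  x ^ zero  = 1#
  x ^ suc r = x * (x ^ r)

  adjMat : {n : ℕ} → Graph n → Mat (Fin n)
  adjMat X i j = if Graph.adj X i j then 1# else 0#

  _·₂_ : {n : ℕ} → Mat (Fin n × Fin n) → Mat (Fin n × Fin n) → Mat (Fin n × Fin n)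
  _·₂_ {n} M N p q = Σ n (λ k → Σ n (λ l → M p (k , l) * N (k , l) q))

  idM₂ : {n : ℕ} → Mat (Fin n × Fin n)
  idM₂ (i , k) (j , l) = δ i j * δ k l

  pow₂ : {n : ℕ} → Mat (Fin n × Fin n) → ℕ → Mat (Fin n × Fin n)
  pow₂ M zero    = idM₂
  pow₂ M (suc r) = M ·₂ pow₂ M r

  -- adjacency matrix of the Cartesian product X □ X :  A ⊗ I + I ⊗ A
  cartSq : {n : ℕ} → Mat (Fin n) → Mat (Fin n × Fin n)
  cartSq A (i , k) (j , l) = A i j * δ k l + δ i j * A k l

  -- coefficient of t^r in the walk generating function W(X □ X, t),
  -- restricted to the diagonal D = {(i,i)} (identified with V(X)):
  -- the (i,j) entry is ((A(X□X))^r)_{(i,i),(j,j)}.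
  walkDiagCoeff : {n : ℕ} → Graph n → ℕ → Mat (Fin n)
  walkDiagCoeff X r i j = pow₂ (cartSq (adjMat X)) r (i , i) (j , j)

  record SpectralDecomposition {n : ℕ} (A : Mat (Fin n)) : Set (c Level.⊔ ℓ) where
    field
      m        : ℕ
      θ        : Fin m → Carrier
      E        : Fin m → Mat (Fin n)
      distinct : ∀ a b → θ a ≈ θ b → a ≡ b
      nonzero  : ∀ a → ¬ (∀ i j → E a i j ≈ 0#)
      symm     : ∀ a i j → E a i j ≈ E a j i
      orthIdem : ∀ a b i j → (E a · E b) i j ≈ δ a b * E a i j
      complete : ∀ i j → Σ m (λ a → E a i j) ≈ idM i j
      decomp   : ∀ i j → Σ m (λ a → θ a * E a i j) ≈ A i j

-- The adjacency matrix of X □ X is A ⊗ I + I ⊗ A.  By the mixed-product rule it maps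
-- E_θ ⊗ E_τ to (θ + τ)(E_θ ⊗ E_τ), and the E_θ ⊗ E_τ sum to I ⊗ I, so its r-th power
-- is Σ_{θ,τ} (θ + τ)^r E_θ ⊗ E_τ.  The entry at ((i,i),(j,j)) of E_θ ⊗ E_τ is
-- (E_θ ∘ E_τ)_{ij}, which is the coefficient of t^r in the claimed series.
module Submission where

open import Defs
open import Level using (Level)
open import Algebra.Bundles using (CommutativeRing)
open import Data.Nat using (ℕ; zero; suc)
open import Data.Fin using (Fin; zero; suc)
open import Data.Fin.Properties using (_≟_)
open import Data.Product using (_×_; _,_)
open import Relation.Nullary using (yes; no)
open import Relation.Binary.PropositionalEquality as ≡ using (_≡_)
import Algebra.Properties.CommutativeSemigroup as CommutativeSemigroupProperties
import Algebra.Properties.Semiring.Sum as SemiringSum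
import Relation.Binary.Reasoning.Setoid as SetoidReasoning

module WalkGeneratingFunction {c ℓ : Level} (R : CommutativeRing c ℓ) where
  open CommutativeRing R hiding (zero)
  open Spectral R
  open SemiringSum semiring
    using (sum; sum-cong-≋; sum-cong-≗; sum-replicate-zero; ∑-distrib-+; ∑-comm; *-distribˡ-sum; *-distribʳ-sum)
  open CommutativeSemigroupProperties *-commutativeSemigroup using (interchange; x∙yz≈y∙xz)
  open SetoidReasoning setoid

  Σ≡sum : ∀ n (f : Fin n → Carrier) → Σ n f ≡ sum f
  Σ≡sum zero    f = ≡.refl
  Σ≡sum (suc n) f = ≡.cong (f zero +_) (Σ≡sum n (λ i → f (suc i)))

  Σ²≡sum² : ∀ m n (f : Fin m → Fin n → Carrier) →
    Σ m (λ i → Σ n (λ j → f i j)) ≡ sum (λ i → sum (λ j → f i j))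
  Σ²≡sum² m n f = ≡.trans (Σ≡sum m _) (sum-cong-≗ (λ i → Σ≡sum n (f i)))

  Σ-cong : ∀ n {f g : Fin n → Carrier} → (∀ i → f i ≈ g i) → Σ n f ≈ Σ n g
  Σ-cong n {f} {g} f≈g rewrite Σ≡sum n f | Σ≡sum n g = sum-cong-≋ f≈g

  Σ-zero : ∀ n → Σ n (λ _ → 0#) ≈ 0#
  Σ-zero n rewrite Σ≡sum n (λ _ → 0#) = sum-replicate-zero n

  Σ-distrib-+ : ∀ n (f g : Fin n → Carrier) → Σ n (λ i → f i + g i) ≈ Σ n f + Σ n g
  Σ-distrib-+ n f g rewrite Σ≡sum n (λ i → f i + g i) | Σ≡sum n f | Σ≡sum n g = ∑-distrib-+ f g

  *-distribˡ-Σ : ∀ n x (f : Fin n → Carrier) → x * Σ n f ≈ Σ n (λ i → x * f i)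
  *-distribˡ-Σ n x f rewrite Σ≡sum n f | Σ≡sum n (λ i → x * f i) = *-distribˡ-sum x f

  *-distribʳ-Σ : ∀ n x (f : Fin n → Carrier) → Σ n f * x ≈ Σ n (λ i → f i * x)
  *-distribʳ-Σ n x f rewrite Σ≡sum n f | Σ≡sum n (λ i → f i * x) = *-distribʳ-sum x f

  Σ-comm : ∀ m n (f : Fin m → Fin n → Carrier) →
    Σ m (λ i → Σ n (λ j → f i j)) ≈ Σ n (λ j → Σ m (λ i → f i j))
  Σ-comm m n f rewrite Σ²≡sum² m n f | Σ²≡sum² n m (λ j i → f i j) = ∑-comm f

  Σ-*-Σ : ∀ m n (f : Fin m → Carrier) (g : Fin n → Carrier) →
    Σ m f * Σ n g ≈ Σ m (λ i → Σ n (λ j → f i * g j))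
  Σ-*-Σ m n f g = begin
    Σ m f * Σ n g                      ≈⟨ *-distribʳ-Σ m _ f ⟩
    Σ m (λ i → f i * Σ n g)            ≈⟨ Σ-cong m (λ i → *-distribˡ-Σ n (f i) g) ⟩
    Σ m (λ i → Σ n (λ j → f i * g j))  ∎

  δ-suc : ∀ {n} (i j : Fin n) → δ (suc i) (suc j) ≡ δ i j
  δ-suc i j with i ≟ j
  ... | yes _ = ≡.refl
  ... | no  _ = ≡.refl

  δ-sym : ∀ {n} (i j : Fin n) → δ i j ≡ δ j i
  δ-sym zero    zero    = ≡.refl
  δ-sym zero    (suc j) = ≡.refl
  δ-sym (suc i) zero    = ≡.refl
  δ-sym (suc i) (suc j) rewrite δ-suc i j | δ-suc j i = δ-sym i j

  Σ-δˡ : ∀ n (i : Fin n) (f : Fin n → Carrier) → Σ n (λ k → δ i k * f k) ≈ f i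
  Σ-δˡ (suc n) zero f = begin
    1# * f zero + Σ n (λ k → 0# * f (suc k))  ≈⟨ +-cong (*-identityˡ _) (Σ-cong n (λ k → zeroˡ _)) ⟩
    f zero + Σ n (λ _ → 0#)                   ≈⟨ +-congˡ (Σ-zero n) ⟩
    f zero + 0#                               ≈⟨ +-identityʳ _ ⟩
    f zero                                    ∎
  Σ-δˡ (suc n) (suc i) f = begin
    0# * f zero + Σ n (λ k → δ (suc i) (suc k) * f (suc k))  ≈⟨ +-cong (zeroˡ _) (Σ-cong n (λ k → *-congʳ (reflexive (δ-suc i k)))) ⟩
    0# + Σ n (λ k → δ i k * f (suc k))                       ≈⟨ +-identityˡ _ ⟩
    Σ n (λ k → δ i k * f (suc k))                            ≈⟨ Σ-δˡ n i (λ k → f (suc k)) ⟩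
    f (suc i)                                                ∎

  Σ-δʳ : ∀ n (i : Fin n) (f : Fin n → Carrier) → Σ n (λ k → δ k i * f k) ≈ f i
  Σ-δʳ n i f = trans (Σ-cong n (λ k → *-congʳ (reflexive (δ-sym k i)))) (Σ-δˡ n i f)

  infix  4 _≋_
  infixl 6 _+ᴹ_
  infixr 7 _•_
  infixr 8 _⊗_

  _≋_ : {I : Set} → Mat I → Mat I → Set ℓ
  M ≋ N = ∀ p q → M p q ≈ N p q

  _+ᴹ_ : {I : Set} → Mat I → Mat I → Mat I
  (M +ᴹ N) p q = M p q + N p q

  _•_ : {I : Set} → Carrier → Mat I → Mat I
  (x • M) p q = x * M p q

  Σᴹ : {I : Set} (m : ℕ) → (Fin m → Mat I) → Mat I
  Σᴹ m F p q = Σ m (λ a → F a p q)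

  _⊗_ : {n : ℕ} → Mat (Fin n) → Mat (Fin n) → Mat (Fin n × Fin n)
  (M ⊗ N) (i , k) (j , l) = M i j * N k l

  idM-· : ∀ {n} (M : Mat (Fin n)) → idM · M ≋ M
  idM-· {n} M i j = Σ-δˡ n i (λ k → M k j)

  ⊗-·₂-⊗ : ∀ {n} (A B E F : Mat (Fin n)) → (A ⊗ B) ·₂ (E ⊗ F) ≋ (A · E) ⊗ (B · F)
  ⊗-·₂-⊗ {n} A B E F (i , k) (j , l) = begin
    Σ n (λ x → Σ n (λ y → (A i x * B k y) * (E x j * F y l)))  ≈⟨ Σ-cong n (λ x → Σ-cong n (λ y → interchange _ _ _ _)) ⟩
    Σ n (λ x → Σ n (λ y → (A i x * E x j) * (B k y * F y l)))  ≈⟨ Σ-*-Σ n n _ _ ⟨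
    (A · E) i j * (B · F) k l                                  ∎

  ·₂-congˡ : ∀ {n} (M : Mat (Fin n × Fin n)) {N N′ : Mat (Fin n × Fin n)} → N ≋ N′ → M ·₂ N ≋ M ·₂ N′
  ·₂-congˡ {n} M N≋N′ p q = Σ-cong n (λ k → Σ-cong n (λ l → *-congˡ (N≋N′ (k , l) q)))

  ·₂-• : ∀ {n} (M N : Mat (Fin n × Fin n)) x → M ·₂ (x • N) ≋ x • (M ·₂ N)
  ·₂-• {n} M N x p q = begin
    Σ n (λ k → Σ n (λ l → M p (k , l) * (x * N (k , l) q)))  ≈⟨ Σ-cong n (λ k → Σ-cong n (λ l → x∙yz≈y∙xz _ _ _)) ⟩
    Σ n (λ k → Σ n (λ l → x * (M p (k , l) * N (k , l) q)))  ≈⟨ Σ-cong n (λ k → *-distribˡ-Σ n x _) ⟨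
    Σ n (λ k → x * Σ n (λ l → M p (k , l) * N (k , l) q))    ≈⟨ *-distribˡ-Σ n x _ ⟨
    x * (M ·₂ N) p q                                         ∎

  ·₂-Σᴹ : ∀ {n} (M : Mat (Fin n × Fin n)) m (G : Fin m → Mat (Fin n × Fin n)) →
    M ·₂ Σᴹ m G ≋ Σᴹ m (λ a → M ·₂ G a)
  ·₂-Σᴹ {n} M m G p q = begin
    Σ n (λ k → Σ n (λ l → M p (k , l) * Σ m (λ a → G a (k , l) q)))  ≈⟨ Σ-cong n (λ k → Σ-cong n (λ l → *-distribˡ-Σ m _ _)) ⟩
    Σ n (λ k → Σ n (λ l → Σ m (λ a → M p (k , l) * G a (k , l) q)))  ≈⟨ Σ-cong n (λ k → Σ-comm n m _) ⟩
    Σ n (λ k → Σ m (λ a → Σ n (λ l → M p (k , l) * G a (k , l) q)))  ≈⟨ Σ-comm n m _ ⟩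
    Σ m (λ a → (M ·₂ G a) p q)                                       ∎

  ·₂-distribʳ-+ : ∀ {n} (M N P : Mat (Fin n × Fin n)) → (M +ᴹ N) ·₂ P ≋ (M ·₂ P) +ᴹ (N ·₂ P)
  ·₂-distribʳ-+ {n} M N P p q = begin
    Σ n (λ k → Σ n (λ l → (M p (k , l) + N p (k , l)) * P (k , l) q))
      ≈⟨ Σ-cong n (λ k → Σ-cong n (λ l → distribʳ _ _ _)) ⟩
    Σ n (λ k → Σ n (λ l → M p (k , l) * P (k , l) q + N p (k , l) * P (k , l) q))
      ≈⟨ Σ-cong n (λ k → Σ-distrib-+ n _ _) ⟩
    Σ n (λ k → Σ n (λ l → M p (k , l) * P (k , l) q) + Σ n (λ l → N p (k , l) * P (k , l) q))
      ≈⟨ Σ-distrib-+ n _ _ ⟩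
    (M ·₂ P) p q + (N ·₂ P) p q
      ∎

  cartSq-eigen : ∀ {n} (A E F : Mat (Fin n)) θ τ → A · E ≋ θ • E → A · F ≋ τ • F →
    cartSq A ·₂ (E ⊗ F) ≋ (θ + τ) • (E ⊗ F)
  cartSq-eigen A E F θ τ AE≋θE AF≋τF p@(i , k) q@(j , l) = begin
    (cartSq A ·₂ (E ⊗ F)) p q
      ≈⟨ ·₂-distribʳ-+ (A ⊗ idM) (idM ⊗ A) (E ⊗ F) p q ⟩
    ((A ⊗ idM) ·₂ (E ⊗ F)) p q + ((idM ⊗ A) ·₂ (E ⊗ F)) p q
      ≈⟨ +-cong (⊗-·₂-⊗ A idM E F p q) (⊗-·₂-⊗ idM A E F p q) ⟩
    (A · E) i j * (idM · F) k l + (idM · E) i j * (A · F) k l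
      ≈⟨ +-cong (*-cong (AE≋θE i j) (idM-· F k l)) (*-cong (idM-· E i j) (AF≋τF k l)) ⟩
    (θ * E i j) * F k l + E i j * (τ * F k l)
      ≈⟨ +-cong (*-assoc _ _ _) (x∙yz≈y∙xz _ _ _) ⟩
    θ * (E i j * F k l) + τ * (E i j * F k l)
      ≈⟨ distribʳ _ _ _ ⟨
    (θ + τ) * (E i j * F k l)
      ∎

  pow₂-eigenexpansion : ∀ {n} (M : Mat (Fin n × Fin n)) m m′
    (μ : Fin m → Fin m′ → Carrier) (F : Fin m → Fin m′ → Mat (Fin n × Fin n)) →
    (∀ a b → M ·₂ F a b ≋ μ a b • F a b) → idM₂ ≋ Σᴹ m (λ a → Σᴹ m′ (F a)) →
    ∀ r → pow₂ M r ≋ Σᴹ m (λ a → Σᴹ m′ (λ b → (μ a b ^ r) • F a b))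
  pow₂-eigenexpansion M m m′ μ F eigen complete zero p q = begin
    idM₂ p q                                           ≈⟨ complete p q ⟩
    Σ m (λ a → Σ m′ (λ b → F a b p q))                 ≈⟨ Σ-cong m (λ a → Σ-cong m′ (λ b → *-identityˡ _)) ⟨
    Σ m (λ a → Σ m′ (λ b → 1# * F a b p q))            ∎
  pow₂-eigenexpansion M m m′ μ F eigen complete (suc r) p q = begin
    (M ·₂ pow₂ M r) p q
      ≈⟨ ·₂-congˡ M (pow₂-eigenexpansion M m m′ μ F eigen complete r) p q ⟩
    (M ·₂ Σᴹ m (λ a → Σᴹ m′ (λ b → (μ a b ^ r) • F a b))) p q
      ≈⟨ ·₂-Σᴹ M m (λ a → Σᴹ m′ (λ b → (μ a b ^ r) • F a b)) p q ⟩
    Σ m (λ a → (M ·₂ Σᴹ m′ (λ b → (μ a b ^ r) • F a b)) p q)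
      ≈⟨ Σ-cong m (λ a → ·₂-Σᴹ M m′ (λ b → (μ a b ^ r) • F a b) p q) ⟩
    Σ m (λ a → Σ m′ (λ b → (M ·₂ ((μ a b ^ r) • F a b)) p q))
      ≈⟨ Σ-cong m (λ a → Σ-cong m′ (λ b → ·₂-• M (F a b) _ p q)) ⟩
    Σ m (λ a → Σ m′ (λ b → (μ a b ^ r) * (M ·₂ F a b) p q))
      ≈⟨ Σ-cong m (λ a → Σ-cong m′ (λ b → *-congˡ (eigen a b p q))) ⟩
    Σ m (λ a → Σ m′ (λ b → (μ a b ^ r) * (μ a b * F a b p q)))
      ≈⟨ Σ-cong m (λ a → Σ-cong m′ (λ b → trans (x∙yz≈y∙xz _ _ _) (sym (*-assoc _ _ _)))) ⟩
    Σ m (λ a → Σ m′ (λ b → (μ a b ^ suc r) * F a b p q))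
      ∎

  module _ {n : ℕ} {A : Mat (Fin n)} (S : SpectralDecomposition A) where
    open SpectralDecomposition S

    -- Multiplying A = Σ_b θ_b E_b by E_a kills every term but b = a.
    A·E≋θ•E : ∀ a → A · E a ≋ θ a • E a
    A·E≋θ•E a p q = begin
      Σ n (λ k → A p k * E a k q)
        ≈⟨ Σ-cong n (λ k → *-congʳ (decomp p k)) ⟨
      Σ n (λ k → Σ m (λ b → θ b * E b p k) * E a k q)
        ≈⟨ Σ-cong n (λ k → trans (*-distribʳ-Σ m _ _) (Σ-cong m (λ b → *-assoc _ _ _))) ⟩
      Σ n (λ k → Σ m (λ b → θ b * (E b p k * E a k q)))
        ≈⟨ Σ-comm n m _ ⟩
      Σ m (λ b → Σ n (λ k → θ b * (E b p k * E a k q)))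
        ≈⟨ Σ-cong m (λ b → trans (*-congˡ (sym (orthIdem b a p q))) (*-distribˡ-Σ n (θ b) _)) ⟨
      Σ m (λ b → θ b * (δ b a * E b p q))
        ≈⟨ Σ-cong m (λ b → x∙yz≈y∙xz _ _ _) ⟩
      Σ m (λ b → δ b a * (θ b * E b p q))
        ≈⟨ Σ-δʳ m a _ ⟩
      θ a * E a p q
        ∎

    idM₂≋ΣΣE⊗E : idM₂ ≋ Σᴹ m (λ a → Σᴹ m (λ b → E a ⊗ E b))
    idM₂≋ΣΣE⊗E (i , k) (j , l) = begin
      δ i j * δ k l                                ≈⟨ *-cong (complete i j) (complete k l) ⟨
      Σ m (λ a → E a i j) * Σ m (λ b → E b k l)    ≈⟨ Σ-*-Σ m m _ _ ⟩
      Σ m (λ a → Σ m (λ b → E a i j * E b k l))    ∎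

    pow₂-cartSq : ∀ r → pow₂ (cartSq A) r ≋ Σᴹ m (λ a → Σᴹ m (λ b → ((θ a + θ b) ^ r) • (E a ⊗ E b)))
    pow₂-cartSq = pow₂-eigenexpansion (cartSq A) m m (λ a b → θ a + θ b) (λ a b → E a ⊗ E b)
      (λ a b → cartSq-eigen A (E a) (E b) (θ a) (θ b) (A·E≋θ•E a) (A·E≋θ•E b))
      idM₂≋ΣΣE⊗E

mainTheorem3 : {c ℓ : Level} (R : CommutativeRing c ℓ) →
  let open CommutativeRing R
      open Spectral R
  in {n : ℕ} (X : Graph n) (S : SpectralDecomposition (adjMat X)) →
     let open SpectralDecomposition S
     in (r : ℕ) (i j : Fin n) →
        walkDiagCoeff X r i j
          ≈ Σ m (λ a → Σ m (λ b → ((θ a + θ b) ^ r) * (E a i j * E b i j)))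
mainTheorem3 R X S r i j = WalkGeneratingFunction.pow₂-cartSq R S r (i , i) (j , j)
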